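{- Let $k$ and $n$ be positive integers with $1 \leqslant k<n$. Suppose there exists a prime $p>\max\{(k+2)(k+3)/2,\ 3k+8\}$ such that \[ \frac{n}{k+3}<p \leqslant \frac{n}{k+1}. \] Then for every $i=1,2,\dots,n$, the number \[ S(n,i,k)=\sum_{\substack{1 \leqslant i_1<i_2<\cdots<i_k \leqslant n,\\ i_j \neq i \text{ for } j=1,2,\dots,k}} \frac{1}{i_1 i_2 \cdots i_k} \] is not an integer.
   Context: For integers $1\leqslant k<n$ and $1\leqslant i\leqslant n$, $S(n,i,k)$ denotes the $k$-th elementary symmetric function of the numbers $\{1,1/2,\dots,1/n\}\setminus\{1/i\}$, as given by the displayed sum. -}

module Defs where

open import Data.Nat as ℕ using (ℕ; zero; suc)
open import Data.Integer using (ℤ; +_)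
open import Data.Rational using (ℚ; 0ℚ; 1ℚ; _+_; _*_; _/_)
open import Data.List using (List; []; _∷_)
open import Relation.Nullary using (yes; no)

-- elementary symmetric function e_k of a list of rationals
-- (sum over all k-element sub-multisets chosen by position, i.e. index sets i_1 < ... < i_k)
esym : ℕ → List ℚ → ℚ
esym zero    xs       = 1ℚ
esym (suc k) []       = 0ℚ
esym (suc k) (x ∷ xs) = x * esym k xs + esym (suc k) xs

recipsWithout : ℕ → ℕ → List ℚ
recipsWithout zero    i = []
recipsWithout (suc m) i with suc m ℕ.≟ i
... | yes _ = recipsWithout m i
... | no  _ = (+ 1 / suc m) ∷ recipsWithout m i

S : ℕ → ℕ → ℕ → ℚ
S n i k = esym k (recipsWithout n i)

{-# OPTIONS --safe #-}
-- Clearing denominators, S(n,i,k) · ∏ L = coesym k L for L = {1,…,n} ∖ {i}, so if S is an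
-- integer then ∏ L divides coesym k L.  Let m be the number of multiples of p in L, so that
-- p^m ∣ ∏ L.  Sorting the omitted factors by divisibility by p gives
-- coesym k L ≡ p^(m-k) · E · Y (mod p^(m-k+1)), where E is coesym k of the quotients x / p and
-- Y is the product of the non-multiples; as k ≥ 1 this forces p ∣ E.  The quotients form
-- {1,…,a} ∖ {i / p} with a = ⌊n / p⌋ ∈ {k + 1, k + 2}, so E is 1, a positive sum of distinct
-- numbers ≤ k + 2, or (k + 1)(k + 2)(k + 3)(3k + 8)/24, and the size of p excludes p ∣ E.
module Submission where

open import Defs
open import Data.Nat using (ℕ; _+_; _*_; _≤_; _<_; _⊔_)
open import Data.Nat.Primality using (Prime)
open import Data.Nat.DivMod using (_/_)
open import Data.Integer using (ℤ)
open import Data.Rational using (ℚ) renaming (_/_ to _/ℚ_)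
open import Data.Product using (Σ; ∃; _×_)
open import Relation.Binary.PropositionalEquality using (_≡_)
open import Relation.Nullary using (¬_)

open import Data.Nat.Base using (zero; suc; _^_; z≤n; s≤s; z<s; NonZero; >-nonZero; >-nonZero⁻¹)
open import Data.Nat.Properties
open import Data.Nat.Divisibility
open import Data.Nat.DivMod using (_%_; m≡m%n+[m/n]*n; m%n<n; m*n/n≡m; /-monoˡ-≤; m<n*o⇒m/o<n)
open import Data.Nat.Primality using (euclidsLemma; prime⇒nonZero; ¬prime[1])
open import Data.Nat.Coprimality using (1-coprimeTo) renaming (sym to coprime-sym)
open import Data.Nat.ListAction using (sum; product)
open import Data.Nat.ListAction.Properties using (sum-↭)
open import Data.Nat.Tactic.RingSolver using (solve-∀)
open import Data.Integer as ℤ using (∣_∣)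
import Data.Integer.Properties as ℤ
open import Data.Rational as ℚ using (mkℚ; 0ℚ; 1ℚ)
import Data.Rational.Properties as ℚ
open import Data.Rational.Solver renaming (module +-*-Solver to ℚ-Solver)
open import Data.List.Base using (List; []; _∷_; length; map)
open import Data.List.Relation.Unary.All using (All; []; _∷_)
open import Data.List.Relation.Binary.Permutation.Propositional
  using (_↭_; prep; swap; ↭-refl; ↭-trans; ↭-reflexive)
open import Data.List.Relation.Binary.Permutation.Propositional.Properties using (↭-length)
open import Data.Product using (_,_; proj₁; proj₂)
open import Data.Sum as Sum using (_⊎_; inj₁; inj₂; [_,_]′)
open import Function using (_∘_; id; _⇔_; Equivalence; mk⇔)
open import Relation.Nullary using (yes; no; contradiction)
open import Relation.Binary.PropositionalEquality
  using (_≢_; refl; sym; trans; cong; cong₂; subst; subst₂; module ≡-Reasoning)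

without : ℕ → ℕ → List ℕ
without zero    i = []
without (suc m) i with suc m ≟ i
... | yes _ = without m i
... | no  _ = suc m ∷ without m i

without-≡ : ∀ {m i} → suc m ≡ i → without (suc m) i ≡ without m i
without-≡ {m} {i} 1+m≡i with suc m ≟ i
... | yes _      = refl
... | no  1+m≢i  = contradiction 1+m≡i 1+m≢i

without-≢ : ∀ {m i} → suc m ≢ i → without (suc m) i ≡ suc m ∷ without m i
without-≢ {m} {i} 1+m≢i with suc m ≟ i
... | yes 1+m≡i = contradiction 1+m≡i 1+m≢i
... | no  _     = refl

without-beyond : ∀ {n i} → n < i → without n i ≡ without n 0
without-beyond {zero}  _   = refl
without-beyond {suc m} n<i =
  trans (without-≢ (<⇒≢ n<i)) (cong (suc m ∷_) (without-beyond (<-trans (n<1+n m) n<i)))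

without-↭ : ∀ {n i} → 1 ≤ i → i ≤ n → without n 0 ↭ i ∷ without n i
without-↭ {zero}  (s≤s z≤n) ()
without-↭ {suc m} {i} 1≤i i≤1+m with suc m ≟ i
... | yes refl  = prep (suc m) (↭-reflexive (sym (without-beyond (n<1+n m))))
... | no  1+m≢i = ↭-trans (prep (suc m) (without-↭ 1≤i i≤m)) (swap (suc m) i ↭-refl)
  where i≤m = ≤-pred (≤∧≢⇒< i≤1+m (1+m≢i ∘ sym))

length-without-0 : ∀ n → length (without n 0) ≡ n
length-without-0 zero    = refl
length-without-0 (suc n) = cong suc (length-without-0 n)

length-without : ∀ {n i} → 1 ≤ i → i ≤ n → suc (length (without n i)) ≡ n
length-without 1≤i i≤n = trans (sym (↭-length (without-↭ 1≤i i≤n))) (length-without-0 _)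

sum-without : ∀ {n i} → 1 ≤ i → i ≤ n → i + sum (without n i) ≡ sum (without n 0)
sum-without 1≤i i≤n = sym (sum-↭ (without-↭ 1≤i i≤n))

2*sum-without-0 : ∀ n → 2 * sum (without n 0) ≡ n * suc n
2*sum-without-0 zero    = refl
2*sum-without-0 (suc n) = begin
  2 * (suc n + sum (without n 0))    ≡⟨ *-distribˡ-+ 2 (suc n) _ ⟩
  2 * suc n + 2 * sum (without n 0)  ≡⟨ cong (2 * suc n +_) (2*sum-without-0 n) ⟩
  2 * suc n + n * suc n              ≡⟨ *-distribʳ-+ (suc n) 2 n ⟨
  (2 + n) * suc n                    ≡⟨ *-comm (2 + n) (suc n) ⟩
  suc n * suc (suc n)                ∎
  where open ≡-Reasoning

sum-without-0≡n*[1+n]/2 : ∀ n → n * suc n / 2 ≡ sum (without n 0)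
sum-without-0≡n*[1+n]/2 n =
  trans (cong (_/ 2) (trans (sym (2*sum-without-0 n)) (*-comm 2 (sum (without n 0)))))
        (m*n/n≡m (sum (without n 0)) 2)

without-nonZero : ∀ n i → All NonZero (without n i)
without-nonZero zero    i = []
without-nonZero (suc m) i with suc m ≟ i
... | yes _ = without-nonZero m i
... | no  _ = _ ∷ without-nonZero m i

sum-pos : ∀ {xs} → All NonZero xs → 0 < length xs → 0 < sum xs
sum-pos {x ∷ xs} (x≢0 ∷ _) _ = <-≤-trans (>-nonZero⁻¹ x {{x≢0}}) (m≤m+n x (sum xs))

-- coesym k xs = Σ over k-sets K of positions of ∏_{j ∉ K} x_j = (∏ xs) · e_k (1 / xs)
coesym : ℕ → List ℕ → ℕ
coesym zero    xs       = product xs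
coesym (suc k) []       = 0
coesym (suc k) (x ∷ xs) = coesym k xs + x * coesym (suc k) xs

coesym-vanishes : ∀ {j} xs → length xs < j → coesym j xs ≡ 0
coesym-vanishes {suc j} []       _       = refl
coesym-vanishes {suc j} (x ∷ xs) (s≤s h)
  rewrite coesym-vanishes xs h | coesym-vanishes xs (m<n⇒m<1+n h) = *-zeroʳ x

coesym-length : ∀ xs → coesym (length xs) xs ≡ 1
coesym-length []       = refl
coesym-length (x ∷ xs)
  rewrite coesym-length xs | coesym-vanishes xs (n<1+n (length xs)) = cong suc (*-zeroʳ x)

coesym-sum : ∀ {k} xs → length xs ≡ suc k → coesym k xs ≡ sum xs
coesym-sum {zero}  (x ∷ [])    refl = trans (*-identityʳ x) (sym (+-identityʳ x))
coesym-sum {suc k} (x ∷ xs)    len  = begin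
  coesym k xs + x * coesym (suc k) xs  ≡⟨ cong₂ (λ s c → s + x * c) (coesym-sum xs len′) all≡1 ⟩
  sum xs + x * 1                       ≡⟨ cong (sum xs +_) (*-identityʳ x) ⟩
  sum xs + x                           ≡⟨ +-comm (sum xs) x ⟩
  x + sum xs                           ∎
  where
  open ≡-Reasoning
  len′ : length xs ≡ suc k
  len′ = suc-injective len
  all≡1 : coesym (suc k) xs ≡ 1
  all≡1 = subst (λ j → coesym j xs ≡ 1) len′ (coesym-length xs)
coesym-sum {zero}  []          ()
coesym-sum {zero}  (_ ∷ _ ∷ _) ()
coesym-sum {suc k} []          ()

coesym-without-0-2+k : ∀ k →
  24 * coesym k (without (2 + k) 0) ≡ product (1 + k ∷ 2 + k ∷ 3 + k ∷ 8 + 3 * k ∷ [])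
coesym-without-0-2+k zero    = refl
coesym-without-0-2+k (suc k) = begin
  24 * (e + (3 + k) * coesym (suc k) L)
    ≡⟨ cong (λ c → 24 * (e + (3 + k) * c)) (coesym-sum L (length-without-0 (2 + k))) ⟩
  24 * (e + (3 + k) * s)
    ≡⟨ regroup k e s ⟩
  24 * e + 12 * (3 + k) * (2 * s)
    ≡⟨ cong₂ (λ a b → a + 12 * (3 + k) * b) (coesym-without-0-2+k k) (2*sum-without-0 (2 + k)) ⟩
  product (1 + k ∷ 2 + k ∷ 3 + k ∷ 8 + 3 * k ∷ []) + 12 * (3 + k) * ((2 + k) * (3 + k))
    ≡⟨ step k ⟩
  product (1 + suc k ∷ 2 + suc k ∷ 3 + suc k ∷ 8 + 3 * suc k ∷ []) ∎
  where
  open ≡-Reasoning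
  L = without (2 + k) 0
  e = coesym k L
  s = sum L
  regroup : ∀ k e s → 24 * (e + (3 + k) * s) ≡ 24 * e + 12 * (3 + k) * (2 * s)
  regroup = solve-∀
  step : ∀ k → (1 + k) * ((2 + k) * ((3 + k) * ((8 + 3 * k) * 1)))
                 + 12 * (3 + k) * ((2 + k) * (3 + k))
             ≡ (1 + suc k) * ((2 + suc k) * ((3 + suc k) * ((8 + 3 * suc k) * 1)))
  step = solve-∀

quotients : ℕ → List ℕ → List ℕ
quotients p []       = []
quotients p (x ∷ xs) with p ∣? x
... | yes (divides q _) = q ∷ quotients p xs
... | no  _             = quotients p xs

nonMultiples : ℕ → List ℕ → List ℕ
nonMultiples p []       = []
nonMultiples p (x ∷ xs) with p ∣? x
... | yes _ = nonMultiples p xs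
... | no  _ = x ∷ nonMultiples p xs

nonMultiples-∤ : ∀ p xs → All (p ∤_) (nonMultiples p xs)
nonMultiples-∤ p []       = []
nonMultiples-∤ p (x ∷ xs) with p ∣? x
... | yes _   = nonMultiples-∤ p xs
... | no  p∤x = p∤x ∷ nonMultiples-∤ p xs

prime∤product : ∀ {p xs} → Prime p → All (p ∤_) xs → p ∤ product xs
prime∤product pp []           p∣1   = ¬prime[1] (subst Prime (∣1⇒≡1 p∣1) pp)
prime∤product pp (p∤x ∷ p∤xs) p∣x*P with euclidsLemma _ _ pp p∣x*P
... | inj₁ p∣x = p∤x p∣x
... | inj₂ p∣P = prime∤product pp p∤xs p∣P

^-length-quotients∣product : ∀ p xs → p ^ length (quotients p xs) ∣ product xs
^-length-quotients∣product p []       = ∣-refl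
^-length-quotients∣product p (x ∷ xs) with p ∣? x
... | yes p∣x = *-pres-∣ p∣x (^-length-quotients∣product p xs)
... | no  _   = ∣n⇒∣m*n x (^-length-quotients∣product p xs)

^-monoʳ-∣ : ∀ p {m n} → m ≤ n → p ^ m ∣ p ^ n
^-monoʳ-∣ p {m} m≤n =
  let o , m+o≡n = m≤n⇒∃[o]m+o≡n m≤n
  in subst (λ e → p ^ m ∣ p ^ e) m+o≡n (subst (p ^ m ∣_) (sym (^-distribˡ-+-* p m o)) (m∣m*n (p ^ o)))

coesym-mod-p^suc : ∀ p xs j d → j + d ≡ length (quotients p xs) →
  ∃ λ q → coesym j xs ≡ p ^ d * (coesym j (quotients p xs) * product (nonMultiples p xs) + p * q)
coesym-mod-p^suc p [] zero zero refl = 0 , cong suc (sym (trans (+-identityʳ (p * 0)) (*-zeroʳ p)))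
coesym-mod-p^suc p (x ∷ xs) j d j+d≡m with p ∣? x
coesym-mod-p^suc p (.(c * p) ∷ xs) zero .(suc _) refl | yes (divides-refl c) =
  let q , ih = coesym-mod-p^suc p xs 0 _ refl
  in c * q , trans (cong (c * p *_) ih) (regroup c p (p ^ length (quotients p xs)) A Y q)
  where
  A = product (quotients p xs)
  Y = product (nonMultiples p xs)
  regroup : ∀ c p P A Y q → c * p * (P * (A * Y + p * q)) ≡ p * P * (c * A * Y + p * (c * q))
  regroup = solve-∀
coesym-mod-p^suc p (.(c * p) ∷ xs) (suc j) zero j+0≡1+m | yes (divides-refl c) =
  let q , ih = coesym-mod-p^suc p xs j 0 (suc-injective j+0≡1+m)
  in q + c * B , (begin
    coesym j xs + c * p * B
      ≡⟨ cong (_+ c * p * B) ih ⟩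
    1 * (A * Y + p * q) + c * p * B
      ≡⟨ regroup c p B A Y q ⟩
    1 * ((A + c * 0) * Y + p * (q + c * B))
      ≡⟨ cong (λ e → 1 * ((A + c * e) * Y + p * (q + c * B))) A′≡0 ⟨
    1 * ((A + c * A′) * Y + p * (q + c * B)) ∎)
  where
  open ≡-Reasoning
  A = coesym j (quotients p xs)
  A′ = coesym (suc j) (quotients p xs)
  B = coesym (suc j) xs
  Y = product (nonMultiples p xs)
  A′≡0 : A′ ≡ 0
  A′≡0 = coesym-vanishes (quotients p xs)
           (≤-reflexive (cong suc (trans (sym (suc-injective j+0≡1+m)) (+-identityʳ j))))
  regroup : ∀ c p B A Y q → 1 * (A * Y + p * q) + c * p * B ≡ 1 * ((A + c * 0) * Y + p * (q + c * B))
  regroup = solve-∀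
coesym-mod-p^suc p (.(c * p) ∷ xs) (suc j) (suc d) j+d≡m | yes (divides-refl c) =
  let q₁ , ih₁ = coesym-mod-p^suc p xs j (suc d) (suc-injective j+d≡m)
      q₂ , ih₂ = coesym-mod-p^suc p xs (suc j) d (trans (sym (+-suc j d)) (suc-injective j+d≡m))
  in q₁ + c * q₂ , trans (cong₂ (λ a b → a + c * p * b) ih₁ ih₂) (regroup c p (p ^ d) A A′ Y q₁ q₂)
  where
  A = coesym j (quotients p xs)
  A′ = coesym (suc j) (quotients p xs)
  Y = product (nonMultiples p xs)
  regroup : ∀ c p P A A′ Y q₁ q₂ → p * P * (A * Y + p * q₁) + c * p * (P * (A′ * Y + p * q₂))
                                  ≡ p * P * ((A + c * A′) * Y + p * (q₁ + c * q₂))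
  regroup = solve-∀
coesym-mod-p^suc p (x ∷ xs) zero d j+d≡m | no _ =
  let q , ih = coesym-mod-p^suc p xs 0 d j+d≡m
  in x * q , trans (cong (x *_) ih) (regroup x p (p ^ d) A Y q)
  where
  A = product (quotients p xs)
  Y = product (nonMultiples p xs)
  regroup : ∀ x p P A Y q → x * (P * (A * Y + p * q)) ≡ P * (A * (x * Y) + p * (x * q))
  regroup = solve-∀
coesym-mod-p^suc p (x ∷ xs) (suc j) d j+d≡m | no _ =
  let q₁ , ih₁ = coesym-mod-p^suc p xs j (suc d) (trans (+-suc j d) j+d≡m)
      q₂ , ih₂ = coesym-mod-p^suc p xs (suc j) d j+d≡m
  in A * Y + p * q₁ + x * q₂ ,
     trans (cong₂ (λ a b → a + x * b) ih₁ ih₂) (regroup x p (p ^ d) A A′ Y q₁ q₂)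
  where
  A = coesym j (quotients p xs)
  A′ = coesym (suc j) (quotients p xs)
  Y = product (nonMultiples p xs)
  regroup : ∀ x p P A A′ Y q₁ q₂ → p * P * (A * Y + p * q₁) + x * (P * (A′ * Y + p * q₂))
                                  ≡ P * (A′ * (x * Y) + p * (A * Y + p * q₁ + x * q₂))
  regroup = solve-∀

p∣coesym-quotients : ∀ {p k w} xs → Prime p → 1 ≤ k → k ≤ length (quotients p xs) →
  w * product xs ≡ coesym k xs → p ∣ coesym k (quotients p xs)
p∣coesym-quotients {p} {k} {w} xs pp 1≤k k≤m w*Π≡E with m≤n⇒∃[o]m+o≡n k≤m
... | d , k+d≡m with coesym-mod-p^suc p xs k d k+d≡m
... | q , E≡ = [ id , (λ p∣Y → contradiction p∣Y (prime∤product pp (nonMultiples-∤ p xs))) ]′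
                 (euclidsLemma A Y pp p∣A*Y)
  where
  instance
    _ = prime⇒nonZero pp
    _ = m^n≢0 p d
  A = coesym k (quotients p xs)
  Y = product (nonMultiples p xs)
  p^[1+d]∣Π : p ^ suc d ∣ product xs
  p^[1+d]∣Π = ∣-trans (^-monoʳ-∣ p (subst (suc d ≤_) k+d≡m (+-monoˡ-≤ d 1≤k)))
                      (^-length-quotients∣product p xs)
  p^d*p∣p^d*[A*Y+p*q] : p ^ d * p ∣ p ^ d * (A * Y + p * q)
  p^d*p∣p^d*[A*Y+p*q] = subst₂ _∣_ (*-comm p (p ^ d)) (trans w*Π≡E E≡) (∣n⇒∣m*n w p^[1+d]∣Π)
  p∣A*Y : p ∣ A * Y
  p∣A*Y = ∣m+n∣m⇒∣n (subst (p ∣_) (+-comm (A * Y) (p * q)) (*-cancelˡ-∣ (p ^ d) p^d*p∣p^d*[A*Y+p*q]))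
                    (m∣m*n q)

quotients-keep : ∀ {p} .{{_ : NonZero p}} q xs → quotients p (q * p ∷ xs) ≡ q ∷ quotients p xs
quotients-keep {p} q xs with p ∣? q * p
... | yes (divides q′ q*p≡q′*p) = cong (_∷ quotients p xs) (*-cancelʳ-≡ q′ q p (sym q*p≡q′*p))
... | no  p∤q*p                = contradiction (n∣m*n q) p∤q*p

quotients-skip : ∀ {p x} xs → p ∤ x → quotients p (x ∷ xs) ≡ quotients p xs
quotients-skip {p} {x} xs p∤x with p ∣? x
... | yes p∣x = contradiction p∣x p∤x
... | no  _   = refl

∤-between : ∀ {p m} → 0 < m → m < p → p ∤ m
∤-between 0<m m<p = >⇒∤ {{>-nonZero 0<m}} m<p

∤-non-multiple : ∀ {p a r} → 0 < r → r < p → p ∤ a * p + r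
∤-non-multiple {a = a} 0<r r<p p∣ap+r = ∤-between 0<r r<p (∣m+n∣m⇒∣n p∣ap+r (n∣m*n a))

quotients-without : ∀ {p i i′} .{{_ : NonZero p}} → (∀ q → suc q * p ≡ i ⇔ suc q ≡ i′) →
  ∀ {n a r} → n ≡ a * p + r → r < p → quotients p (without n i) ≡ without a i′
quotients-without         i≈i′ {zero}  {zero}          _  _ = refl
quotients-without {suc _} i≈i′ {suc m} {zero}  {zero}  () _
quotients-without {suc _} i≈i′ {zero}  {suc a}         () _
quotients-without {p} {i} i≈i′ {suc m} {a} {suc r} 1+m≡ap+1+r r<p with suc m ≟ i
... | yes _ = quotients-without i≈i′ {a = a} m≡ap+r r<p′
  where
  m≡ap+r = suc-injective (trans 1+m≡ap+1+r (+-suc (a * p) r))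
  r<p′ = <-trans (n<1+n r) r<p
... | no  _ = trans (quotients-skip (without m i) p∤1+m) (quotients-without i≈i′ {a = a} m≡ap+r r<p′)
  where
  m≡ap+r = suc-injective (trans 1+m≡ap+1+r (+-suc (a * p) r))
  r<p′ = <-trans (n<1+n r) r<p
  p∤1+m = subst (p ∤_) (sym 1+m≡ap+1+r) (∤-non-multiple {a = a} z<s r<p)
quotients-without {suc p′} {i} {i′} i≈i′ {suc m} {suc a} {zero} 1+m≡[1+a]p+0 _ with suc m ≟ i
... | yes 1+m≡i = trans (quotients-without i≈i′ {a = a} m≡ap+p′ ≤-refl)
                        (sym (without-≡ (Equivalence.to (i≈i′ a) (trans (sym 1+m≡[1+a]p) 1+m≡i))))
  where
  1+m≡[1+a]p = trans 1+m≡[1+a]p+0 (+-identityʳ _)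
  m≡ap+p′ = trans (suc-injective 1+m≡[1+a]p) (+-comm p′ (a * suc p′))
... | no  1+m≢i = begin
  quotients p (suc m ∷ without m i)
    ≡⟨ cong (λ x → quotients p (x ∷ without m i)) 1+m≡[1+a]p ⟩
  quotients p (suc a * p ∷ without m i)
    ≡⟨ quotients-keep (suc a) (without m i) ⟩
  suc a ∷ quotients p (without m i)
    ≡⟨ cong (suc a ∷_) (quotients-without i≈i′ {a = a} m≡ap+p′ ≤-refl) ⟩
  suc a ∷ without a i′
    ≡⟨ without-≢ (1+m≢i ∘ trans 1+m≡[1+a]p ∘ Equivalence.from (i≈i′ a)) ⟨
  without (suc a) i′
    ∎
  where
  open ≡-Reasoning
  p = suc p′
  1+m≡[1+a]p = trans 1+m≡[1+a]p+0 (+-identityʳ _)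
  m≡ap+p′ = trans (suc-injective 1+m≡[1+a]p) (+-comm p′ (a * p))

-- i′ is i / p when p ∣ i, and 0 (so that nothing is removed from 1, …, n / p) otherwise.
removed-quotient : ∀ {p i n} .{{_ : NonZero p}} → 1 ≤ i → i ≤ n →
  ∃ λ i′ → (∀ q → suc q * p ≡ i ⇔ suc q ≡ i′) × (i′ ≡ 0 ⊎ 1 ≤ i′ × i′ ≤ n / p)
removed-quotient {p} {i} {n} 1≤i i≤n with p ∣? i
... | yes (divides c i≡c*p) = c , c≈i , inj₂ (1≤c , c≤n/p)
  where
  c≈i : ∀ q → suc q * p ≡ i ⇔ suc q ≡ c
  c≈i q = mk⇔ (λ e → *-cancelʳ-≡ (suc q) c p (trans e i≡c*p)) (λ { refl → sym i≡c*p })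
  1≤c : 1 ≤ c
  1≤c = n≢0⇒n>0 (λ { refl → <⇒≢ 1≤i (sym i≡c*p) })
  c≤n/p : c ≤ n / p
  c≤n/p = subst (_≤ n / p) (m*n/n≡m c p) (/-monoˡ-≤ p (subst (_≤ n) i≡c*p i≤n))
... | no p∤i = 0 , (λ q → mk⇔ (λ e → contradiction (divides (suc q) (sym e)) p∤i) (λ ())) , inj₁ refl

n≡m⊎n≡1+m : ∀ {m n} → m ≤ n → n ≤ suc m → n ≡ m ⊎ n ≡ suc m
n≡m⊎n≡1+m z≤n       z≤n         = inj₁ refl
n≡m⊎n≡1+m z≤n       (s≤s z≤n)   = inj₂ refl
n≡m⊎n≡1+m (s≤s m≤n) (s≤s n≤1+m) = Sum.map (cong suc) (cong suc) (n≡m⊎n≡1+m m≤n n≤1+m)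

quotient-range : ∀ {n p k} .{{_ : NonZero p}} → (k + 1) * p ≤ n → n < (k + 3) * p →
  n / p ≡ 1 + k ⊎ n / p ≡ 2 + k
quotient-range {n} {p} {k} [k+1]p≤n n<[k+3]p = n≡m⊎n≡1+m
  (subst (_≤ n / p) (trans (m*n/n≡m (k + 1) p) (+-comm k 1)) (/-monoˡ-≤ p [k+1]p≤n))
  (≤-pred (subst (n / p <_) (+-comm k 3) (m<n*o⇒m/o<n n<[k+3]p)))

∤-coesym-sum : ∀ {p k} xs → length xs ≡ suc k → 0 < sum xs → sum xs < p → p ∤ coesym k xs
∤-coesym-sum {p} xs len 0<s s<p = ∤-between 0<s s<p ∘ subst (p ∣_) (coesym-sum xs len)

p∤coesym-without : ∀ {p k a i′} → Prime p → sum (without (2 + k) 0) < p → 8 + 3 * k < p →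
  a ≡ 1 + k ⊎ a ≡ 2 + k → i′ ≡ 0 ⊎ 1 ≤ i′ × i′ ≤ a →
  k ≤ length (without a i′) × p ∤ coesym k (without a i′)
p∤coesym-without {p} {k} pp T<p _ (inj₁ refl) (inj₁ refl) =
  subst (k ≤_) (sym len) (n≤1+n k) ,
  ∤-coesym-sum (without (1 + k) 0) len z<s (≤-<-trans (m≤n+m _ (2 + k)) T<p)
  where len = length-without-0 (1 + k)
p∤coesym-without {p} {k} {i′ = i′} pp _ _ (inj₁ refl) (inj₂ (1≤i′ , i′≤a)) =
  ≤-reflexive (sym len) ,
  prime∤product pp [] ∘ subst (p ∣_) (subst (λ j → coesym j L ≡ 1) len (coesym-length L))
  where
  L = without (1 + k) i′
  len : length L ≡ k
  len = suc-injective (length-without 1≤i′ i′≤a)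
p∤coesym-without {p} {k} {i′ = i′} pp T<p _ (inj₂ refl) (inj₂ (1≤i′ , i′≤a)) =
  subst (k ≤_) (sym len) (n≤1+n k) ,
  ∤-coesym-sum L len (sum-pos (without-nonZero (2 + k) i′) (subst (0 <_) (sym len) z<s))
    (≤-<-trans (subst (sum L ≤_) (sum-without 1≤i′ i′≤a) (m≤n+m (sum L) i′)) T<p)
  where
  L = without (2 + k) i′
  len : length L ≡ 1 + k
  len = suc-injective (length-without 1≤i′ i′≤a)
p∤coesym-without {p} {k} pp _ 8+3k<p (inj₂ refl) (inj₁ refl) =
  subst (k ≤_) (sym (length-without-0 (2 + k))) (m≤n+m k 2) ,
  prime∤product pp (p∤ 1+k<p ∷ p∤ 2+k<p ∷ p∤ 3+k<p ∷ p∤ 8+3k<p ∷ [])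
    ∘ subst (p ∣_) (coesym-without-0-2+k k) ∘ ∣n⇒∣m*n 24
  where
  p∤ : ∀ {m} → suc m < p → p ∤ suc m
  p∤ = ∤-between z<s
  3+k<p : 3 + k < p
  3+k<p = ≤-<-trans (+-mono-≤ (m≤m+n 3 5) (m≤n*m k 3)) 8+3k<p
  2+k<p = <-trans (n<1+n (2 + k)) 3+k<p
  1+k<p = <-trans (n<1+n (1 + k)) 2+k<p

product∤coesym : ∀ {p k n i} → Prime p → 1 ≤ k → (k + 2) * (k + 3) / 2 ⊔ (3 * k + 8) < p →
  (k + 1) * p ≤ n → n < (k + 3) * p → 1 ≤ i → i ≤ n →
  product (without n i) ∤ coesym k (without n i)
product∤coesym {p} {k} {n} {i} pp 1≤k p-large [k+1]p≤n n<[k+3]p 1≤i i≤n (divides w E≡w*Π)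
  with removed-quotient {{prime⇒nonZero pp}} 1≤i i≤n
... | i′ , i≈i′ , i′-range = proj₂ p∤E (subst (λ l → p ∣ coesym k l) qs≡ p∣E)
  where
  instance _ = prime⇒nonZero pp
  T<p : sum (without (2 + k) 0) < p
  T<p = subst (_< p) (trans (cong (_/ 2) (cong₂ _*_ (+-comm k 2) (+-comm k 3)))
                            (sum-without-0≡n*[1+n]/2 (2 + k)))
              (m⊔n<o⇒m<o _ _ p-large)
  8+3k<p : 8 + 3 * k < p
  8+3k<p = subst (_< p) (+-comm (3 * k) 8) (m⊔n<o⇒n<o _ _ p-large)
  qs≡ : quotients p (without n i) ≡ without (n / p) i′
  qs≡ = quotients-without i≈i′ {a = n / p} (trans (m≡m%n+[m/n]*n n p) (+-comm (n % p) _)) (m%n<n n p)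
  p∤E : k ≤ length (without (n / p) i′) × p ∤ coesym k (without (n / p) i′)
  p∤E = p∤coesym-without pp T<p 8+3k<p (quotient-range {k = k} [k+1]p≤n n<[k+3]p) i′-range
  p∣E : p ∣ coesym k (quotients p (without n i))
  p∣E = p∣coesym-quotients {w = w} (without n i) pp 1≤k
          (subst (λ l → k ≤ length l) (sym qs≡) (proj₁ p∤E)) (sym E≡w*Π)

fromℕ : ℕ → ℚ
fromℕ n = ℤ.+ n /ℚ 1

-- recip 0 = 0 is a junk value: recip is only applied to nonzero entries.
recip : ℕ → ℚ
recip zero    = 0ℚ
recip (suc n) = ℤ.+ 1 /ℚ suc n

/1≡mkℚ : ∀ z → z /ℚ 1 ≡ mkℚ z 0 (coprime-sym (1-coprimeTo ∣ z ∣))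
/1≡mkℚ z = ℚ.↥p/↧p≡p (mkℚ z 0 (coprime-sym (1-coprimeTo ∣ z ∣)))

/1-homo-* : ∀ a b → (a /ℚ 1) ℚ.* (b /ℚ 1) ≡ (a ℤ.* b) /ℚ 1
/1-homo-* a b = cong₂ ℚ._*_ (/1≡mkℚ a) (/1≡mkℚ b)

/1-homo-+ : ∀ a b → (a /ℚ 1) ℚ.+ (b /ℚ 1) ≡ (a ℤ.+ b) /ℚ 1
/1-homo-+ a b = trans (cong₂ ℚ._+_ (/1≡mkℚ a) (/1≡mkℚ b))
                      (cong (_/ℚ 1) (cong₂ ℤ._+_ (ℤ.*-identityʳ a) (ℤ.*-identityʳ b)))

/1-injective : ∀ {a b} → a /ℚ 1 ≡ b /ℚ 1 → a ≡ b
/1-injective {a} {b} eq = cong ℚ.↥_ (trans (sym (/1≡mkℚ a)) (trans eq (/1≡mkℚ b)))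

fromℕ-+ : ∀ m n → fromℕ (m + n) ≡ fromℕ m ℚ.+ fromℕ n
fromℕ-+ m n = trans (cong (_/ℚ 1) (ℤ.pos-+ m n)) (sym (/1-homo-+ (ℤ.+ m) (ℤ.+ n)))

fromℕ-* : ∀ m n → fromℕ (m * n) ≡ fromℕ m ℚ.* fromℕ n
fromℕ-* m n = trans (cong (_/ℚ 1) (ℤ.pos-* m n)) (sym (/1-homo-* (ℤ.+ m) (ℤ.+ n)))

recip-inverseˡ : ∀ n .{{_ : NonZero n}} → recip n ℚ.* fromℕ n ≡ 1ℚ
recip-inverseˡ (suc m) =
  trans (cong₂ ℚ._*_ (ℚ.normalize-coprime (1-coprimeTo (suc m))) (/1≡mkℚ (ℤ.+ suc m)))
        (ℚ.*-inverseˡ (mkℚ (ℤ.+ suc m) 0 (coprime-sym (1-coprimeTo (suc m)))))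

esym-map-recip : ∀ k {xs} → All NonZero xs →
  esym k (map recip xs) ℚ.* fromℕ (product xs) ≡ fromℕ (coesym k xs)
esym-map-recip zero    _  = ℚ.*-identityˡ _
esym-map-recip (suc k) [] = ℚ.*-zeroˡ (fromℕ 1)
esym-map-recip (suc k) {x ∷ xs} (x≢0 ∷ xs≢0) = begin
  (recip x ℚ.* e ℚ.+ e′) ℚ.* fromℕ (x * Π)
    ≡⟨ cong ((recip x ℚ.* e ℚ.+ e′) ℚ.*_) (fromℕ-* x Π) ⟩
  (recip x ℚ.* e ℚ.+ e′) ℚ.* (fromℕ x ℚ.* fromℕ Π)
    ≡⟨ regroup (recip x) (fromℕ x) e e′ (fromℕ Π) ⟩
  recip x ℚ.* fromℕ x ℚ.* (e ℚ.* fromℕ Π) ℚ.+ fromℕ x ℚ.* (e′ ℚ.* fromℕ Π)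
    ≡⟨ cong₂ (λ u v → u ℚ.+ fromℕ x ℚ.* v)
             (cong₂ ℚ._*_ (recip-inverseˡ x {{x≢0}}) (esym-map-recip k xs≢0))
             (esym-map-recip (suc k) xs≢0) ⟩
  1ℚ ℚ.* fromℕ E ℚ.+ fromℕ x ℚ.* fromℕ E′
    ≡⟨ cong₂ ℚ._+_ (ℚ.*-identityˡ (fromℕ E)) (sym (fromℕ-* x E′)) ⟩
  fromℕ E ℚ.+ fromℕ (x * E′)
    ≡⟨ fromℕ-+ E (x * E′) ⟨
  fromℕ (E + x * E′) ∎
  where
  open ≡-Reasoning
  open ℚ-Solver
  e = esym k (map recip xs)
  e′ = esym (suc k) (map recip xs)
  Π = product xs
  E = coesym k xs
  E′ = coesym (suc k) xs
  regroup : ∀ r s e e′ P →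
    (r ℚ.* e ℚ.+ e′) ℚ.* (s ℚ.* P) ≡ r ℚ.* s ℚ.* (e ℚ.* P) ℚ.+ s ℚ.* (e′ ℚ.* P)
  regroup = solve 5 (λ r s e e′ P →
    (r :* e :+ e′) :* (s :* P) := r :* s :* (e :* P) :+ s :* (e′ :* P)) refl

recipsWithout≡map-recip : ∀ n i → recipsWithout n i ≡ map recip (without n i)
recipsWithout≡map-recip zero    i = refl
recipsWithout≡map-recip (suc m) i with suc m ≟ i
... | yes _ = recipsWithout≡map-recip m i
... | no  _ = cong (recip (suc m) ∷_) (recipsWithout≡map-recip m i)

S*product≡coesym : ∀ n i k → S n i k ℚ.* fromℕ (product (without n i)) ≡ fromℕ (coesym k (without n i))
S*product≡coesym n i k =
  trans (cong (λ xs → esym k xs ℚ.* fromℕ (product (without n i))) (recipsWithout≡map-recip n i))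
        (esym-map-recip k (without-nonZero n i))

z*m≡n⇒∣z∣*m≡n : ∀ z m n → (z /ℚ 1) ℚ.* fromℕ m ≡ fromℕ n → ∣ z ∣ * m ≡ n
z*m≡n⇒∣z∣*m≡n z m n eq =
  trans (sym (ℤ.abs-* z (ℤ.+ m)))
        (cong ∣_∣ (/1-injective {z ℤ.* ℤ.+ m} {ℤ.+ n} (trans (sym (/1-homo-* z (ℤ.+ m))) eq)))

lemma2p2 : (k n : ℕ) → 1 ≤ k → k < n →
    Σ ℕ (λ p → Prime p
      × (((k + 2) * (k + 3)) / 2 ⊔ (3 * k + 8)) < p
      × n < (k + 3) * p
      × (k + 1) * p ≤ n) →
    (i : ℕ) → 1 ≤ i → i ≤ n →
    ¬ (Σ ℤ (λ z → S n i k ≡ z /ℚ 1))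
-- k < n is implied by (k + 1) * p ≤ n.
lemma2p2 k n 1≤k _ (p , pp , p-large , n<[k+3]p , [k+1]p≤n) i 1≤i i≤n (z , S≡z) =
  product∤coesym pp 1≤k p-large [k+1]p≤n n<[k+3]p 1≤i i≤n (divides ∣ z ∣ (sym ∣z∣*Π≡E))
  where
  ∣z∣*Π≡E : ∣ z ∣ * product (without n i) ≡ coesym k (without n i)
  ∣z∣*Π≡E = z*m≡n⇒∣z∣*m≡n z _ _ (trans (cong (ℚ._* _) (sym S≡z)) (S*product≡coesym n i k))
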